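{- For all terms $q,q'$, if $q\to_{\mathrm{CLC}_0} q'$ then $q\to_R q'$.
   Context: Terms are built from variables and the constants $C,T,F,K,S$ by binary application, left-associated; rules apply in any context. $\mathrm{CLC}_0$ has rules $C\,T\,x\,y\to x$; $C\,F\,x\,y\to y$; $C\,z\,x\,x\to x$; $K\,x\,y\to x$; $S\,x\,y\,z\to x\,z\,(y\,z)$. $\mathrm{CLC}$ is the conditional system with rules $C\,T\,x\,y\to x$; $C\,F\,x\,y\to y$; $C\,z\,x\,y\to x \Leftarrow x=y$; $K\,x\,y\to x$; $S\,x\,y\,z\to x\,z\,(y\,z)$, where $=$ is convertibility in $\mathrm{CLC}$ itself, defined by levels ($\mathrm{CLC}_{(0)}$ interprets $=$ as empty, $\mathrm{CLC}_{(n+1)}$ as convertibility of $\mathrm{CLC}_{(n)}$, $\to_{\mathrm{CLC}}=\bigcup_n\to_{\mathrm{CLC}_{(n)}}$); $=_{\mathrm{CLC}}$ denotes $\mathrm{CLC}$-convertibility. $R$ is the conditional system with rules: $C\,T\,x\,y\to x$; $C\,z\,x\,y\to y \Leftarrow z=_{\mathrm{CLC}} F$; $C\,z\,x\,y\to x\Leftarrow z\neq_{\mathrm{CLC}} F \wedge x=_{\mathrm{CLC}} y$; $K\,x\,y\to x$; $S\,x\,y\,z\to x\,z\,(y\,z)$. -}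

module Defs where

open import Data.Nat using (ℕ)
open import Data.Empty using (⊥)
open import Data.Product using (Σ; _×_)
open import Relation.Nullary using (¬_)
open import Relation.Binary.Core using (Rel)
open import Relation.Binary.Construct.Closure.Equivalence using (EqClosure)
open import Level using (0ℓ)

infixl 9 _·_
data Term : Set where
  var : ℕ → Term
  C T F K S : Term
  _·_ : Term → Term → Term

data _→CLC₀_ : Rel Term 0ℓ where
  ct   : ∀ x y → (C · T · x · y) →CLC₀ x
  cf   : ∀ x y → (C · F · x · y) →CLC₀ y
  cxx  : ∀ z x → (C · z · x · x) →CLC₀ x
  k    : ∀ x y → (K · x · y) →CLC₀ x
  s    : ∀ x y z → (S · x · y · z) →CLC₀ (x · z · (y · z))
  appL : ∀ {p p'} q → p →CLC₀ p' → (p · q) →CLC₀ (p' · q)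
  appR : ∀ p {q q'} → q →CLC₀ q' → (p · q) →CLC₀ (p · q')

data CStep (E : Rel Term 0ℓ) : Rel Term 0ℓ where
  ct   : ∀ x y → CStep E (C · T · x · y) x
  cf   : ∀ x y → CStep E (C · F · x · y) y
  cxy  : ∀ z x y → E x y → CStep E (C · z · x · y) x
  k    : ∀ x y → CStep E (K · x · y) x
  s    : ∀ x y z → CStep E (S · x · y · z) (x · z · (y · z))
  appL : ∀ {p p'} q → CStep E p p' → CStep E (p · q) (p' · q)
  appR : ∀ p {q q'} → CStep E q q' → CStep E (p · q) (p · q')

CLCLevel : ℕ → Rel Term 0ℓ
CLCLevel ℕ.zero    = CStep (λ _ _ → ⊥)
CLCLevel (ℕ.suc n) = CStep (EqClosure (CLCLevel n))

_→CLC_ : Rel Term 0ℓ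
p →CLC q = Σ ℕ (λ n → CLCLevel n p q)

_=CLC_ : Rel Term 0ℓ
_=CLC_ = EqClosure _→CLC_

data _→R_ : Rel Term 0ℓ where
  ct   : ∀ x y → (C · T · x · y) →R x
  cF   : ∀ z x y → z =CLC F → (C · z · x · y) →R y
  cxy  : ∀ z x y → ¬ (z =CLC F) → x =CLC y → (C · z · x · y) →R x
  k    : ∀ x y → (K · x · y) →R x
  s    : ∀ x y z → (S · x · y · z) →R (x · z · (y · z))
  appL : ∀ {p p'} q → p →R p' → (p · q) →R (p' · q)
  appR : ∀ p {q q'} → q →R q' → (p · q) →R (p · q')

module Submission where

-- Every CLC₀ rule except C z x x → x is literally a rule of R, the C F x y → y
-- rule being the instance z = F of R's conditional F-rule.  For C z x x → x
-- decide (classically) whether z =CLC F: if so, R's F-rule gives x as the second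
-- argument; otherwise its third rule applies because x =CLC x.

open import Defs
open import Level using (0ℓ)
open import Axiom.ExcludedMiddle using (ExcludedMiddle)
open import Relation.Nullary using (yes; no)
open import Relation.Binary.Construct.Closure.Equivalence using (reflexive)

=CLC-refl : ∀ {x} → x =CLC x
=CLC-refl = reflexive _→CLC_

C-diagonal→R : ExcludedMiddle 0ℓ → ∀ z x → (C · z · x · x) →R x
C-diagonal→R em z x with em {z =CLC F}
... | yes z=F = cF z x x z=F
... | no  z≠F = cxy z x x z≠F =CLC-refl

mainTheorem6 : ExcludedMiddle 0ℓ → ∀ (q q' : Term) → q →CLC₀ q' → q →R q'
mainTheorem6 em _ _ (ct x y)   = ct x y
mainTheorem6 em _ _ (cf x y)   = cF F x y =CLC-refl
mainTheorem6 em _ _ (cxx z x)  = C-diagonal→R em z x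
mainTheorem6 em _ _ (k x y)    = k x y
mainTheorem6 em _ _ (s x y z)  = s x y z
mainTheorem6 em _ _ (appL q r) = appL q (mainTheorem6 em _ _ r)
mainTheorem6 em _ _ (appR p r) = appR p (mainTheorem6 em _ _ r)
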